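{- Let $m\ge 2$ be an integer and $n$ an even positive integer, and let $\{x_{i,j}\}$ be a $C_4$-face-magic Klein bottle labeling of $\mathcal{K}_{m,n}$. Then its $C_4$-face-magic value is $S=2(mn+1)$.
   Context: The $m\times n$ Klein bottle grid graph $\mathcal{K}_{m,n}$ has vertex set $\{(i,j):1\le i\le m,\ 1\le j\le n\}$ and edges $(i,j)(i,j+1)$ for $1\le j\le n-1$; $(i,n)(i,1)$; $(i,j)(i+1,j)$ for $1\le i\le m-1$; and $(m,j)(1,n+1-j)$ for $1\le j\le n$. Its $4$-cycle faces in the natural Klein bottle embedding are, with column indices modulo $n$, $\{(i,j),(i,j+1),(i+1,j),(i+1,j+1)\}$ for $1\le i\le m-1$, $1\le j\le n$, and $\{(m,j),(m,j+1),(1,n+1-j),(1,n-j)\}$ for $1\le j\le n$. A $C_4$-face-magic Klein bottle labeling is a bijection $(i,j)\mapsto x_{i,j}$ onto $\{1,\dots,mn\}$ such that the sum of labels over every such face equals a common constant $S$, called the $C_4$-face-magic value. -}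

module Defs where

open import Data.Nat using (ℕ; zero; suc; _+_; _*_; _∸_)
open import Data.Nat.DivMod using (_%_; m%n<n)
open import Data.Fin using (Fin; toℕ; fromℕ<; opposite)
open import Data.Product using (_×_; _,_)
open import Relation.Binary.PropositionalEquality using (_≡_)

-- Indices are 0-based: paper's vertex (i,j) is (i-1, j-1) here, i : Fin m, j : Fin n.

sucMod : ∀ {n} → Fin n → Fin n
sucMod {suc k} j = fromℕ< (m%n<n (suc (toℕ j)) (suc k))

predMod : ∀ {n} → Fin n → Fin n
predMod {suc k} j = fromℕ< (m%n<n (toℕ j + k) (suc k))

-- The labeling x_{i,j} = 1 + f(i,j) where f is a bijection onto Fin (m*n),
-- i.e. (i,j) ↦ x_{i,j} is a bijection onto {1,…,mn}.
label : ∀ {m n} → (Fin m × Fin n → Fin (m * n)) → Fin m → Fin n → ℕ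
label f i j = suc (toℕ (f (i , j)))

-- Every 4-cycle face of the natural Klein bottle embedding of K_{m,n} has label sum S.
-- (1) faces {(i,j),(i,j+1),(i+1,j),(i+1,j+1)} for consecutive rows i, i' = i+1;
-- (2) faces {(m,j),(m,j+1),(1,n+1-j),(1,n-j)}: in 0-based form, last row i = m-1,
--     first row z = 0, and columns opposite j = n-1-j and n-2-j (mod n).
IsC4FaceMagic : (m n : ℕ) → (Fin m → Fin n → ℕ) → ℕ → Set
IsC4FaceMagic m n x S =
    (∀ (i i' : Fin m) → toℕ i' ≡ suc (toℕ i) → ∀ (j : Fin n) →
       x i j + x i (sucMod j) + x i' j + x i' (sucMod j) ≡ S)
  × (∀ (i z : Fin m) → toℕ i ≡ m ∸ 1 → toℕ z ≡ 0 → ∀ (j : Fin n) →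
       x i j + x i (sucMod j) + x z (opposite j) + x z (predMod (opposite j)) ≡ S)

{-# OPTIONS --safe #-}
module Submission where

-- Each row of the grid is adjacent, cyclically, to exactly two others, the pair (last row,
-- first row) being joined through the twisted faces.  Summing the n faces between two adjacent
-- rows counts each label of both rows twice, since the column maps involved (j ↦ j+1 and the
-- reflections j ↦ n-1-j, n-2-j) permute the columns.  Summing over all m row pairs therefore
-- counts every label four times: m n S = 4 (1 + ⋯ + mn) = 2 mn (mn + 1).  Neither the parity
-- of n nor m ≥ 2 enters this count.

open import Defs
open import Data.Nat using (ℕ; zero; suc; _+_; _*_; _≤_; _<_; s≤s; NonZero)
open import Data.Nat.Divisibility using (_∣_)
open import Data.Nat.DivMod using (_%_; m%n<n; %-distribˡ-+; m%n%n≡m%n; [m+n]%n≡m%n; m<n⇒m%n≡m)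
open import Data.Nat.Properties using (+-comm; +-suc; *-assoc; *-distribˡ-+; *-cancelˡ-≡; +-*-semiring)
open import Data.Nat.Solver using (module +-*-Solver)
open import Data.Fin as Fin using (Fin; toℕ; opposite; inject₁; fromℕ; combine; remQuot; _↑ˡ_; _↑ʳ_)
open import Data.Fin.Properties
  using (toℕ-fromℕ<; toℕ-injective; toℕ<n; opposite-involutive; toℕ-inject₁; toℕ-fromℕ; remQuot-combine; *↔×)
open import Data.Fin.Permutation using (Permutation′; permutation; _⟨$⟩ʳ_; flip; id)
open import Data.Product using (_×_; _,_)
open import Function using (_∘_)
open import Function.Bundles using (mk⤖)
open import Function.Construct.Composition using (_↔-∘_)
open import Function.Definitions using (Bijective)
open import Function.Properties.Bijection using (⤖⇒↔)
open import Relation.Binary.PropositionalEquality using (_≡_; refl; sym; trans; cong; cong₂; module ≡-Reasoning)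
open import Algebra.Properties.Semiring.Sum +-*-semiring
  using (sum; sum-syntax; sum-cong-≗; sum-permute; ∑-distrib-+; sum-init-last; *-distribˡ-sum)

open +-*-Solver
open ≡-Reasoning

[m%d+n]%d≡[m+n]%d : ∀ m n d .{{_ : NonZero d}} → (m % d + n) % d ≡ (m + n) % d
[m%d+n]%d≡[m+n]%d m n d = begin
  (m % d + n) % d           ≡⟨ %-distribˡ-+ (m % d) n d ⟩
  (m % d % d + n % d) % d   ≡⟨ cong (λ t → (t + n % d) % d) (m%n%n≡m%n m d) ⟩
  (m % d + n % d) % d       ≡⟨ %-distribˡ-+ m n d ⟨
  (m + n) % d               ∎

suc[j+k]%[1+k]≡j : ∀ {k} (j : Fin (suc k)) → suc (toℕ j + k) % suc k ≡ toℕ j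
suc[j+k]%[1+k]≡j {k} j = begin
  suc (toℕ j + k) % suc k   ≡⟨ cong (_% suc k) (+-suc (toℕ j) k) ⟨
  (toℕ j + suc k) % suc k   ≡⟨ [m+n]%n≡m%n (toℕ j) (suc k) ⟩
  toℕ j % suc k             ≡⟨ m<n⇒m%n≡m (toℕ<n j) ⟩
  toℕ j                     ∎

sucMod-predMod : ∀ {k} (j : Fin (suc k)) → sucMod (predMod j) ≡ j
sucMod-predMod {k} j = toℕ-injective (begin
  toℕ (sucMod (predMod j))         ≡⟨ toℕ-fromℕ< (m%n<n (suc (toℕ (predMod j))) (suc k)) ⟩
  suc (toℕ (predMod j)) % suc k    ≡⟨ cong (λ t → suc t % suc k) (toℕ-fromℕ< (m%n<n (toℕ j + k) (suc k))) ⟩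
  suc ((toℕ j + k) % suc k) % suc k ≡⟨ cong (_% suc k) (+-comm 1 ((toℕ j + k) % suc k)) ⟩
  ((toℕ j + k) % suc k + 1) % suc k ≡⟨ [m%d+n]%d≡[m+n]%d (toℕ j + k) 1 (suc k) ⟩
  (toℕ j + k + 1) % suc k           ≡⟨ cong (_% suc k) (+-comm (toℕ j + k) 1) ⟩
  suc (toℕ j + k) % suc k           ≡⟨ suc[j+k]%[1+k]≡j j ⟩
  toℕ j                             ∎)

predMod-sucMod : ∀ {k} (j : Fin (suc k)) → predMod (sucMod j) ≡ j
predMod-sucMod {k} j = toℕ-injective (begin
  toℕ (predMod (sucMod j))          ≡⟨ toℕ-fromℕ< (m%n<n (toℕ (sucMod j) + k) (suc k)) ⟩
  (toℕ (sucMod j) + k) % suc k      ≡⟨ cong (λ t → (t + k) % suc k) (toℕ-fromℕ< (m%n<n (suc (toℕ j)) (suc k))) ⟩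
  (suc (toℕ j) % suc k + k) % suc k ≡⟨ [m%d+n]%d≡[m+n]%d (suc (toℕ j)) k (suc k) ⟩
  suc (toℕ j + k) % suc k           ≡⟨ suc[j+k]%[1+k]≡j j ⟩
  toℕ j                             ∎)

rotate : ∀ {k} → Permutation′ (suc k)
rotate = permutation sucMod predMod sucMod-predMod predMod-sucMod

reflect : ∀ {n} → Permutation′ n
reflect = permutation opposite opposite opposite-involutive opposite-involutive

sum-const : ∀ n c → ∑[ _ < n ] c ≡ n * c
sum-const zero    c = refl
sum-const (suc n) c = cong (c +_) (sum-const n c)

sum-split : ∀ a b (g : Fin (a + b) → ℕ) → sum g ≡ sum (g ∘ (_↑ˡ b)) + sum (g ∘ (a ↑ʳ_))
sum-split zero    b g = refl
sum-split (suc a) b g = begin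
  g Fin.zero + sum (g ∘ Fin.suc)
    ≡⟨ cong (g Fin.zero +_) (sum-split a b (g ∘ Fin.suc)) ⟩
  g Fin.zero + (sum (g ∘ Fin.suc ∘ (_↑ˡ b)) + sum (g ∘ (suc a ↑ʳ_)))
    ≡⟨ solve 3 (λ x y z → x :+ (y :+ z) := x :+ y :+ z) refl (g Fin.zero) _ _ ⟩
  g Fin.zero + sum (g ∘ Fin.suc ∘ (_↑ˡ b)) + sum (g ∘ (suc a ↑ʳ_)) ∎

sum-combine : ∀ m n (g : Fin (m * n) → ℕ) → sum g ≡ ∑[ i < m ] ∑[ j < n ] g (combine i j)
sum-combine zero    n g = refl
sum-combine (suc m) n g =
  trans (sum-split n (m * n) g) (cong (sum (λ j → g (j ↑ˡ (m * n))) +_) (sum-combine m n (g ∘ (n ↑ʳ_))))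

sum-remQuot : ∀ m n (h : Fin m × Fin n → ℕ) → sum (h ∘ remQuot {m} n) ≡ ∑[ i < m ] ∑[ j < n ] h (i , j)
sum-remQuot m n h = trans (sum-combine m n (h ∘ remQuot n))
  (sum-cong-≗ (λ i → sum-cong-≗ (λ j → cong h (remQuot-combine i j))))

sum-suc-toℕ : ∀ n → 2 * ∑[ i < n ] suc (toℕ i) ≡ n * suc n
sum-suc-toℕ zero    = refl
sum-suc-toℕ (suc n) = begin
  2 * ∑[ i < suc n ] suc (toℕ i)
    ≡⟨ cong (2 *_) (sum-init-last {n} (λ i → suc (toℕ i))) ⟩
  2 * (∑[ i < n ] suc (toℕ (inject₁ i)) + suc (toℕ (fromℕ n)))
    ≡⟨ cong₂ (λ s t → 2 * (s + suc t)) (sum-cong-≗ {n} (cong suc ∘ toℕ-inject₁)) (toℕ-fromℕ n) ⟩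
  2 * (∑[ i < n ] suc (toℕ i) + suc n)
    ≡⟨ *-distribˡ-+ 2 (∑[ i < n ] suc (toℕ i)) (suc n) ⟩
  2 * ∑[ i < n ] suc (toℕ i) + 2 * suc n
    ≡⟨ cong (_+ 2 * suc n) (sum-suc-toℕ n) ⟩
  n * suc n + 2 * suc n
    ≡⟨ solve 1 (λ x → x :* (con 1 :+ x) :+ con 2 :* (con 1 :+ x) := (con 1 :+ x) :* (con 2 :+ x)) refl n ⟩
  suc n * suc (suc n) ∎

sum-label : ∀ m n (f : Fin m × Fin n → Fin (m * n)) → Bijective _≡_ _≡_ f →
  2 * ∑[ i < m ] ∑[ j < n ] label f i j ≡ (m * n) * suc (m * n)
sum-label m n f bij = begin
  2 * ∑[ i < m ] ∑[ j < n ] label f i j  ≡⟨ cong (2 *_) (sum-remQuot m n (suc ∘ toℕ ∘ f)) ⟨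
  2 * sum (suc ∘ toℕ ∘ f ∘ remQuot n)    ≡⟨ cong (2 *_) (sum-permute (suc ∘ toℕ) (⤖⇒↔ (mk⤖ bij) ↔-∘ *↔×)) ⟨
  2 * ∑[ k < m * n ] suc (toℕ k)         ≡⟨ sum-suc-toℕ (m * n) ⟩
  (m * n) * suc (m * n)                  ∎

face-constant⇒row-sums : ∀ {n} (u v : Fin n → ℕ) (p r q : Permutation′ n) {S} →
  (∀ j → u j + u (p ⟨$⟩ʳ j) + v (r ⟨$⟩ʳ j) + v (q ⟨$⟩ʳ j) ≡ S) → 2 * (sum u + sum v) ≡ n * S
face-constant⇒row-sums {n} u v p r q {S} face = begin
  2 * (sum u + sum v)
    ≡⟨ solve 2 (λ a b → con 2 :* (a :+ b) := a :+ a :+ b :+ b) refl (sum u) (sum v) ⟩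
  sum u + sum u + sum v + sum v
    ≡⟨ cong₂ (λ a b → sum u + a + b + sum v) (sum-permute u p) (sum-permute v r) ⟩
  sum u + sum (u ∘ (p ⟨$⟩ʳ_)) + sum (v ∘ (r ⟨$⟩ʳ_)) + sum v
    ≡⟨ cong (sum u + sum (u ∘ (p ⟨$⟩ʳ_)) + sum (v ∘ (r ⟨$⟩ʳ_)) +_) (sum-permute v q) ⟩
  sum u + sum (u ∘ (p ⟨$⟩ʳ_)) + sum (v ∘ (r ⟨$⟩ʳ_)) + sum (v ∘ (q ⟨$⟩ʳ_))
    ≡⟨ cong (λ t → t + sum (v ∘ (r ⟨$⟩ʳ_)) + sum (v ∘ (q ⟨$⟩ʳ_))) (∑-distrib-+ u (u ∘ (p ⟨$⟩ʳ_))) ⟨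
  ∑[ j < n ] (u j + u (p ⟨$⟩ʳ j)) + sum (v ∘ (r ⟨$⟩ʳ_)) + sum (v ∘ (q ⟨$⟩ʳ_))
    ≡⟨ cong (_+ sum (v ∘ (q ⟨$⟩ʳ_))) (∑-distrib-+ (λ j → u j + u (p ⟨$⟩ʳ j)) (v ∘ (r ⟨$⟩ʳ_))) ⟨
  ∑[ j < n ] (u j + u (p ⟨$⟩ʳ j) + v (r ⟨$⟩ʳ j)) + sum (v ∘ (q ⟨$⟩ʳ_))
    ≡⟨ ∑-distrib-+ (λ j → u j + u (p ⟨$⟩ʳ j) + v (r ⟨$⟩ʳ j)) (v ∘ (q ⟨$⟩ʳ_)) ⟨
  ∑[ j < n ] (u j + u (p ⟨$⟩ʳ j) + v (r ⟨$⟩ʳ j) + v (q ⟨$⟩ʳ j))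
    ≡⟨ sum-cong-≗ face ⟩
  ∑[ _ < n ] S
    ≡⟨ sum-const n S ⟩
  n * S ∎

sum-cyclic-pairs : ∀ {k} (R : Fin (suc k) → ℕ) →
  ∑[ i < k ] (R (inject₁ i) + R (Fin.suc i)) + (R (fromℕ k) + R Fin.zero) ≡ 2 * sum R
sum-cyclic-pairs {k} R = begin
  ∑[ i < k ] (R (inject₁ i) + R (Fin.suc i)) + (R (fromℕ k) + R Fin.zero)
    ≡⟨ cong (_+ (R (fromℕ k) + R Fin.zero)) (∑-distrib-+ (R ∘ inject₁) (R ∘ Fin.suc)) ⟩
  sum (R ∘ inject₁) + sum (R ∘ Fin.suc) + (R (fromℕ k) + R Fin.zero)
    ≡⟨ solve 4 (λ a b l z → a :+ b :+ (l :+ z)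
                         := (a :+ l) :+ (z :+ b))
               refl (sum (R ∘ inject₁)) (sum (R ∘ Fin.suc)) (R (fromℕ k)) (R Fin.zero) ⟩
  (sum (R ∘ inject₁) + R (fromℕ k)) + sum R
    ≡⟨ cong (_+ sum R) (sum-init-last R) ⟨
  sum R + sum R
    ≡⟨ solve 1 (λ x → x :+ x := con 2 :* x) refl (sum R) ⟩
  2 * sum R ∎

lemma2p7 : ∀ (m n : ℕ) → 2 ≤ m → 0 < n → 2 ∣ n →
    (f : Fin m × Fin n → Fin (m * n)) → Bijective _≡_ _≡_ f →
    (S : ℕ) → IsC4FaceMagic m n (label f) S →
    S ≡ 2 * (m * n + 1)
lemma2p7 (suc k) (suc n′) (s≤s _) (s≤s _) _ f bij S (face , twisted-face) =
  *-cancelˡ-≡ S (2 * (N + 1)) N (begin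
    N * S                                                  ≡⟨ *-assoc (suc k) n S ⟩
    n * S + k * (n * S)                                    ≡⟨ +-comm (n * S) (k * (n * S)) ⟩
    k * (n * S) + n * S                                    ≡⟨ cong (_+ n * S) (sum-const k (n * S)) ⟨
    ∑[ _ < k ] (n * S) + n * S                             ≡⟨ cong₂ _+_ (sum-cong-≗ adjacent) seam ⟨
    ∑[ i < k ] (2 * pair (inject₁ i) (Fin.suc i)) + 2 * pair (fromℕ k) Fin.zero
      ≡⟨ cong (_+ 2 * pair (fromℕ k) Fin.zero) (*-distribˡ-sum {k} 2 (λ i → pair (inject₁ i) (Fin.suc i))) ⟨
    2 * ∑[ i < k ] pair (inject₁ i) (Fin.suc i) + 2 * pair (fromℕ k) Fin.zero
      ≡⟨ *-distribˡ-+ 2 (∑[ i < k ] pair (inject₁ i) (Fin.suc i)) (pair (fromℕ k) Fin.zero) ⟨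
    2 * (∑[ i < k ] pair (inject₁ i) (Fin.suc i) + pair (fromℕ k) Fin.zero)
      ≡⟨ cong (2 *_) (sum-cyclic-pairs R) ⟩
    2 * (2 * sum R)                                        ≡⟨ cong (2 *_) (sum-label (suc k) n f bij) ⟩
    2 * (N * suc N)                                        ≡⟨ solve 1 (λ x → con 2 :* (x :* (con 1 :+ x)) := x :* (con 2 :* (x :+ con 1))) refl N ⟩
    N * (2 * (N + 1))                                      ∎)
  where
  n N : ℕ
  n = suc n′
  N = suc k * n
  R : Fin (suc k) → ℕ
  R i = sum (label f i)
  pair : Fin (suc k) → Fin (suc k) → ℕ
  pair i i′ = R i + R i′
  adjacent : ∀ i → 2 * pair (inject₁ i) (Fin.suc i) ≡ n * S
  adjacent i = face-constant⇒row-sums (label f (inject₁ i)) (label f (Fin.suc i)) rotate id rotate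
    (face (inject₁ i) (Fin.suc i) (cong suc (sym (toℕ-inject₁ i))))
  seam : 2 * pair (fromℕ k) Fin.zero ≡ n * S
  seam = face-constant⇒row-sums (label f (fromℕ k)) (label f Fin.zero) rotate reflect (flip rotate ↔-∘ reflect)
    (twisted-face (fromℕ k) Fin.zero (toℕ-fromℕ k) refl)
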